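{- Let $n\ge 2$, $1\le t\le n-1$, $T=3^t$. Let $C$ be the ternary code of length $3^n$ with parity check matrix $H_{n,t}$, let $\mathcal{D}$ be the triple system on $V=\{1,\dots,3^n\}$ whose blocks are the supports of all weight-$3$ codewords of $C$ with all nonzero entries equal to $1$, and for $u\in\mathrm{GF}(3)^{n-t}$ let $G_u$ be the set of indices $i$ such that the $i$-th column of $B_{n,t}$ equals $u$. Let $\mathcal{S}$ be any Steiner triple system on $V$ all of whose blocks are blocks of $\mathcal{D}$, with block set $\mathcal{B}$. Then $\mathcal{B}$ is the disjoint union of: (1) for each $u\in\mathrm{GF}(3)^{n-t}$, a set $\mathcal{B}_u$ of $T(T-1)/6$ blocks such that $(G_u,\mathcal{B}_u)$ is a Steiner triple system on $G_u$; (2) for each line $\ell=\{a,b,c\}$ of the affine geometry $AG(n-t,3)$, a set $\mathcal{B}_\ell$ of $T^2=3^{2t}$ blocks forming a transversal design $TD[3;T]$ on the three groups $G_a,G_b,G_c$.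
   Context: $B_{n,t}$ is the $(n-t)\times 3^n$ ternary matrix obtained by deleting $t$ rows from an $n\times 3^n$ matrix whose columns are all distinct vectors of $\mathrm{GF}(3)^n$; its columns consist of each vector of $\mathrm{GF}(3)^{n-t}$ exactly $3^t$ times. $H_{n,t}$ is the matrix with first row the all-one vector and remaining rows those of $B_{n,t}$, and $C=\{c\in\mathrm{GF}(3)^{3^n}:H_{n,t}c^T=0\}$. The points of $AG(n-t,3)$ are the vectors of $\mathrm{GF}(3)^{n-t}$ and its lines are the triples $\{a,b,c\}$ of distinct vectors with $a+b+c=0$. A Steiner triple system on $V$ is a set of $3$-subsets such that every $2$-subset of $V$ lies in exactly one of them. A transversal design $TD[3;g]$ on three disjoint groups of size $g$ is a set of $3$-subsets each meeting every group in one point such that any two points from different groups lie in exactly one of them. -}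

module Defs where

open import Data.Nat using (ℕ; zero; suc; _+_; _*_; _∸_; _^_; _≤_; _<_)
open import Data.Nat.DivMod using (_mod_)
open import Data.Fin as Fin using (Fin; toℕ)
import Data.Fin.Properties as FinP
open import Data.Fin.Subset as Sub using (Subset; ∣_∣; _∩_; outside; inside)
open import Data.Vec as Vec using (Vec; lookup; tabulate; zipWith; foldr)
import Data.Vec.Properties as VecP
open import Data.Bool using (Bool; true; false; if_then_else_)
open import Data.List as List using (List)
open import Data.List.Membership.Propositional as ListM using ()
open import Data.List.Relation.Unary.Unique.Propositional using (Unique)
open import Data.Product using (Σ; ∃; _×_; _,_)
open import Relation.Nullary using (¬_; does)
open import Relation.Binary.PropositionalEquality using (_≡_; _≢_)
open import Data.Sum using (_⊎_)

F3 : Set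
F3 = Fin 3

_+₃_ : F3 → F3 → F3
a +₃ b = (toℕ a + toℕ b) mod 3

_*₃_ : F3 → F3 → F3
a *₃ b = (toℕ a * toℕ b) mod 3

0₃ 1₃ : F3
0₃ = Fin.zero
1₃ = Fin.suc Fin.zero

Σ₃ : ∀ {k} → Vec F3 k → F3
Σ₃ = foldr _ _+₃_ 0₃

dot : ∀ {k} → Vec F3 k → Vec F3 k → F3
dot x y = Σ₃ (zipWith _*₃_ x y)

zeroV : ∀ k → Vec F3 k
zeroV k = Vec.replicate k 0₃

_+V_ : ∀ {k} → Vec F3 k → Vec F3 k → Vec F3 k
_+V_ = zipWith _+₃_

-- The matrix B_{n,t}
-- cols : Fin (3^n) → Vec F3 n   enumerates the columns of the n × 3^n
--        matrix whose columns are all distinct vectors of GF(3)^n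
--        (injective; with 3^n columns, it is then a bijection).
-- keep : Fin (n ∸ t) → Fin n    the (strictly increasing) indices of the
--        rows that are NOT deleted.

colB : ∀ {n m} → (Fin (3 ^ n) → Vec F3 n) → (Fin m → Fin n) → Fin (3 ^ n) → Vec F3 m
colB cols keep i = tabulate (λ r → lookup (cols i) (keep r))

rowB : ∀ {n m} → (Fin (3 ^ n) → Vec F3 n) → (Fin m → Fin n) → Fin m → Vec F3 (3 ^ n)
rowB cols keep r = tabulate (λ i → lookup (cols i) (keep r))

-- membership in the code C with parity-check matrix H_{n,t}
-- (first row the all-one vector, remaining rows those of B_{n,t})
IsCodeword : ∀ {n m} → (Fin (3 ^ n) → Vec F3 n) → (Fin m → Fin n) → Vec F3 (3 ^ n) → Set
IsCodeword {n} cols keep c =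
  (dot (Vec.replicate (3 ^ n) 1₃) c ≡ 0₃) × (∀ r → dot (rowB cols keep r) c ≡ 0₃)

indicator : ∀ {N} → Subset N → Vec F3 N
indicator = Vec.map (λ b → if b then 1₃ else 0₃)

IsDBlock : ∀ {n m} → (Fin (3 ^ n) → Vec F3 n) → (Fin m → Fin n) → Subset (3 ^ n) → Set
IsDBlock cols keep s = (∣ s ∣ ≡ 3) × IsCodeword cols keep (indicator s)

G : ∀ {n m} → (Fin (3 ^ n) → Vec F3 n) → (Fin m → Fin n) → Vec F3 m → Subset (3 ^ n)
G cols keep u = tabulate (λ i → does (VecP.≡-dec FinP._≟_ (colB cols keep i) u))

IsSTS : ∀ {N} → Subset N → List (Subset N) → Set
IsSTS {N} P blocks =
  Unique blocks
  × (∀ b → b ListM.∈ blocks → (∣ b ∣ ≡ 3) × (b Sub.⊆ P))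
  × (∀ (i j : Fin N) → i Sub.∈ P → j Sub.∈ P → i ≢ j →
       Σ (Subset N) λ b → (b ListM.∈ blocks) × (i Sub.∈ b) × (j Sub.∈ b))
  × (∀ (i j : Fin N) → i ≢ j → ∀ b b' → b ListM.∈ blocks → b' ListM.∈ blocks →
       i Sub.∈ b → j Sub.∈ b → i Sub.∈ b' → j Sub.∈ b' → b ≡ b')

Disjoint : ∀ {N} → Subset N → Subset N → Set
Disjoint P Q = P ∩ Q ≡ Sub.⊥

DiffGroups : ∀ {N} → Subset N → Subset N → Subset N → Fin N → Fin N → Set
DiffGroups G₁ G₂ G₃ i j =
    (i Sub.∈ G₁ × j Sub.∈ G₂) ⊎ (i Sub.∈ G₁ × j Sub.∈ G₃)
  ⊎ (i Sub.∈ G₂ × j Sub.∈ G₁) ⊎ (i Sub.∈ G₂ × j Sub.∈ G₃)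
  ⊎ (i Sub.∈ G₃ × j Sub.∈ G₁) ⊎ (i Sub.∈ G₃ × j Sub.∈ G₂)

IsTD : ∀ {N} → Subset N → Subset N → Subset N → ℕ → List (Subset N) → Set
IsTD {N} G₁ G₂ G₃ g blocks =
  (∣ G₁ ∣ ≡ g) × (∣ G₂ ∣ ≡ g) × (∣ G₃ ∣ ≡ g)
  × Disjoint G₁ G₂ × Disjoint G₁ G₃ × Disjoint G₂ G₃
  × Unique blocks
  × (∀ b → b ListM.∈ blocks →
       (∣ b ∣ ≡ 3) × (∣ b ∩ G₁ ∣ ≡ 1) × (∣ b ∩ G₂ ∣ ≡ 1) × (∣ b ∩ G₃ ∣ ≡ 1))
  × (∀ (i j : Fin N) → DiffGroups G₁ G₂ G₃ i j →
       Σ (Subset N) λ b → (b ListM.∈ blocks) × (i Sub.∈ b) × (j Sub.∈ b))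
  × (∀ (i j : Fin N) → DiffGroups G₁ G₂ G₃ i j → ∀ b b' →
       b ListM.∈ blocks → b' ListM.∈ blocks →
       i Sub.∈ b → j Sub.∈ b → i Sub.∈ b' → j Sub.∈ b' → b ≡ b')

-- Lines of AG(m,3): triples of distinct points with a + b + c = 0

IsLine : ∀ {m} → Vec F3 m → Vec F3 m → Vec F3 m → Set
IsLine {m} a b c = (a ≢ b) × (a ≢ c) × (b ≢ c) × ((a +V b) +V c ≡ zeroV m)

-- {a',b',c'} ⊆ {a,b,c} (for two lines: equality as sets)
_∈₃_ : ∀ {m} → Vec F3 m → (Vec F3 m × Vec F3 m × Vec F3 m) → Set
x ∈₃ (a , b , c) = (x ≡ a) ⊎ (x ≡ b) ⊎ (x ≡ c)

SameLine : ∀ {m} → (Vec F3 m × Vec F3 m × Vec F3 m) → (Vec F3 m × Vec F3 m × Vec F3 m) → Set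
SameLine L (a' , b' , c') = (a' ∈₃ L) × (b' ∈₃ L) × (c' ∈₃ L)

-- A block of D is the support {p, q, r} of a codeword of weight 3 with entries 1; the
-- parity checks with the rows of B_{n,t} say that the columns of p, q, r sum to zero in GF(3)^(n-t).
-- In characteristic 3 this forces the three columns to be either all equal, so that the block lies in a
-- single group G_u, or pairwise distinct and then a line {a, b, c} of AG(n-t,3), so that the block meets
-- each of G_a, G_b, G_c in exactly one point.  Splitting the blocks of S along this dichotomy gives the
-- pieces: two points of G_u lie in a unique block of S, whose third column is forced to be u, and a point
-- of G_a and a point of G_b lie in a unique block, whose third column is forced to be c.  Since the columns
-- of B_{n,t} take every value 3^t times, |G_u| = 3^t, and the sizes follow by double counting pairs.

module Submission where

open import Defs
open import Data.Nat using (ℕ; _*_; _∸_; _^_; _≤_; _<_; _/_)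
open import Data.Fin using (Fin)
open import Data.Fin.Subset using (Subset; ⊤)
open import Data.Vec using (Vec)
open import Data.List using (List; length)
open import Data.List.Membership.Propositional using (_∈_; _∉_)
open import Data.List.Relation.Unary.All using (All)
open import Data.Product using (Σ; _×_; _,_)
open import Data.Sum using (_⊎_)
open import Function.Bundles using (_⇔_)
open import Relation.Binary.PropositionalEquality using (_≡_)

open import Level using (0ℓ)
open import Algebra.Bundles using (AbelianGroup)
open import Algebra.Structures using (IsAbelianGroup)
open import Data.Nat as ℕ using (zero; suc; _+_; z≤n; s≤s)
import Data.Nat.Properties as ℕP
open import Data.Nat.DivMod using (m*n/n≡m)
open import Data.Nat.ListAction using (sum)
open import Data.Fin as Fin using (_↑ˡ_; _↑ʳ_; combine; punchOut; finToFun; funToFin; toℕ)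
open import Data.Fin.Properties as FinP using (_≟_; all?)
open import Data.Fin.Permutation using (permutation)
open import Data.Fin.Subset as Subset using (∣_∣; _∩_; inside; outside; ⁅_⁆)
open import Data.Fin.Subset.Properties as SubsetP using (_∈?_)
open import Data.List as List using ([]; _∷_; filter)
import Data.List.Properties as ListP
import Data.List.Membership.Propositional.Properties as ListMP
open import Data.List.Relation.Unary.Any using (here; there)
import Data.List.Relation.Unary.All as All
open import Data.List.Relation.Unary.Unique.Propositional using (Unique)
import Data.List.Relation.Unary.Unique.Propositional.Properties as UniqueP
import Data.List.Relation.Unary.AllPairs as AllPairs
open import Data.Vec as Vec using ([]; _∷_; lookup; tabulate)
import Data.Vec.Properties as VecP
open import Data.Product using (∃; ∃₂; proj₁; proj₂)
open import Data.Sum as Sum using (inj₁; inj₂; [_,_]′; map₂; swap)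
open import Function using (_∘_; mk⇔)
open import Function.Definitions using (Injective)
open import Relation.Binary using (_Preserves_⟶_; tri<; tri≈; tri>)
open import Relation.Nullary using (¬_; Dec; yes; no; does; _×-dec_; ¬?; contradiction)
open import Relation.Nullary.Decidable as Dec using (from-yes; dec-true)
open import Relation.Binary.PropositionalEquality using (_≢_; refl; sym; trans; cong; cong₂; subst; subst₂; isEquivalence; module ≡-Reasoning)
open import Algebra.Properties.Semiring.Sum ℕP.+-*-semiring
  using (sum-syntax; sum-cong-≗; ∑-distrib-+; ∑-permute; sum-replicate-zero; *-distribˡ-sum; *-distribʳ-sum)

𝟙 : ∀ {a} {A : Set a} → Dec A → ℕ
𝟙 (yes _) = 1
𝟙 (no _)  = 0

𝟙-yes : ∀ {a} {A : Set a} (a? : Dec A) → A → 𝟙 a? ≡ 1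
𝟙-yes (yes _) _ = refl
𝟙-yes (no ¬a) a = contradiction a ¬a

𝟙-no : ∀ {a} {A : Set a} (a? : Dec A) → ¬ A → 𝟙 a? ≡ 0
𝟙-no (yes a) ¬a = contradiction a ¬a
𝟙-no (no _)  _  = refl

𝟙-cong : ∀ {a b} {A : Set a} {B : Set b} (a? : Dec A) (b? : Dec B) → (A → B) → (B → A) → 𝟙 a? ≡ 𝟙 b?
𝟙-cong (yes a) b? to from = sym (𝟙-yes b? (to a))
𝟙-cong (no ¬a) b? to from = sym (𝟙-no b? (¬a ∘ from))

𝟙-× : ∀ {a b} {A : Set a} {B : Set b} (a? : Dec A) (b? : Dec B) → 𝟙 (a? ×-dec b?) ≡ 𝟙 a? * 𝟙 b?
𝟙-× (yes _) (yes _) = refl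
𝟙-× (yes _) (no _)  = refl
𝟙-× (no _)  _       = refl

∑-↑ : ∀ m n (f : Fin (m + n) → ℕ) → ∑[ k < m + n ] f k ≡ ∑[ i < m ] f (i ↑ˡ n) + ∑[ j < n ] f (m ↑ʳ j)
∑-↑ zero    n f = refl
∑-↑ (suc m) n f = trans (cong (f Fin.zero +_) (∑-↑ m n (f ∘ Fin.suc))) (sym (ℕP.+-assoc (f Fin.zero) _ _))

∑-combine : ∀ m n (f : Fin (m * n) → ℕ) → ∑[ k < m * n ] f k ≡ ∑[ i < m ] ∑[ j < n ] f (combine i j)
∑-combine zero    n f = refl
∑-combine (suc m) n f = trans (∑-↑ n (m * n) f) (cong (∑[ j < n ] f (j ↑ˡ (m * n)) +_) (∑-combine m n _))

∑-*ʳ : ∀ N (f : Fin N → ℕ) c → ∑[ i < N ] (f i * c) ≡ (∑[ i < N ] f i) * c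
∑-*ʳ N f c = sym (*-distribʳ-sum c f)

injective⇒surjective : ∀ {N} (σ : Fin N → Fin N) → Injective _≡_ _≡_ σ → ∀ k → ∃ λ i → σ i ≡ k
injective⇒surjective {suc N} σ σ-inj k with FinP.any? (λ i → σ i ≟ k)
... | yes hit = hit
... | no ¬hit = contradiction (FinP.injective⇒≤ avoid-k-injective) ℕP.1+n≰n
  where
  avoid-k : Fin (suc N) → Fin N
  avoid-k i = punchOut {i = k} (λ k≡σi → ¬hit (i , sym k≡σi))
  avoid-k-injective : Injective _≡_ _≡_ avoid-k
  avoid-k-injective {i} {j} = σ-inj ∘ FinP.punchOut-injective (λ k≡σi → ¬hit (i , sym k≡σi)) (λ k≡σj → ¬hit (j , sym k≡σj))

∑-reindex : ∀ {N} (σ : Fin N → Fin N) → Injective _≡_ _≡_ σ → (f : Fin N → ℕ) →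
            ∑[ i < N ] f (σ i) ≡ ∑[ k < N ] f k
∑-reindex {N} σ σ-inj f = sym (∑-permute f (permutation σ σ⁻¹ (proj₂ ∘ surj) (λ i → σ-inj (proj₂ (surj (σ i))))))
  where
  surj : ∀ k → ∃ λ i → σ i ≡ k
  surj = injective⇒surjective σ σ-inj
  σ⁻¹ : Fin N → Fin N
  σ⁻¹ = proj₁ ∘ surj

∈?-tail : ∀ {N x} (p : Subset N) j → 𝟙 (j ∈? p) ≡ 𝟙 (Fin.suc j ∈? (x ∷ p))
∈?-tail p j = 𝟙-cong (j ∈? p) (Fin.suc j ∈? (_ ∷ p)) Vec.there SubsetP.drop-there

∣p∣≡∑𝟙 : ∀ {N} (p : Subset N) → ∣ p ∣ ≡ ∑[ j < N ] 𝟙 (j ∈? p)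
∣p∣≡∑𝟙 []            = refl
∣p∣≡∑𝟙 (inside  ∷ p) = cong suc (trans (∣p∣≡∑𝟙 p) (sum-cong-≗ (∈?-tail p)))
∣p∣≡∑𝟙 (outside ∷ p) = trans (∣p∣≡∑𝟙 p) (sum-cong-≗ (∈?-tail p))

∑-𝟙-≟ : ∀ {N} (i : Fin N) → ∑[ j < N ] 𝟙 (i ≟ j) ≡ 1
∑-𝟙-≟ {N} i = begin
  ∑[ j < N ] 𝟙 (i ≟ j)      ≡⟨ sum-cong-≗ (λ j → 𝟙-cong (i ≟ j) (j ∈? ⁅ i ⁆)
                                  (λ { refl → SubsetP.x∈⁅x⁆ i }) (sym ∘ SubsetP.x∈⁅y⁆⇒x≡y i)) ⟩
  ∑[ j < N ] 𝟙 (j ∈? ⁅ i ⁆) ≡⟨ sym (∣p∣≡∑𝟙 ⁅ i ⁆) ⟩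
  ∣ ⁅ i ⁆ ∣                 ≡⟨ SubsetP.∣⁅x⁆∣≡1 i ⟩
  1                         ∎
  where open ≡-Reasoning

∑∑-𝟙-× : ∀ {N} (s t : Subset N) →
         ∑[ i < N ] ∑[ j < N ] 𝟙 (i ∈? s ×-dec j ∈? t) ≡ ∣ s ∣ * ∣ t ∣
∑∑-𝟙-× {N} s t = begin
  ∑[ i < N ] ∑[ j < N ] 𝟙 (i ∈? s ×-dec j ∈? t)
    ≡⟨ sum-cong-≗ (λ i → sum-cong-≗ (λ j → 𝟙-× (i ∈? s) (j ∈? t))) ⟩
  ∑[ i < N ] ∑[ j < N ] (𝟙 (i ∈? s) * 𝟙 (j ∈? t))
    ≡⟨ sum-cong-≗ (λ i → sym (*-distribˡ-sum (𝟙 (i ∈? s)) (λ j → 𝟙 (j ∈? t)))) ⟩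
  ∑[ i < N ] (𝟙 (i ∈? s) * ∑[ j < N ] 𝟙 (j ∈? t))
    ≡⟨ ∑-*ʳ N _ _ ⟩
  (∑[ i < N ] 𝟙 (i ∈? s)) * ∑[ j < N ] 𝟙 (j ∈? t)
    ≡⟨ sym (cong₂ _*_ (∣p∣≡∑𝟙 s) (∣p∣≡∑𝟙 t)) ⟩
  ∣ s ∣ * ∣ t ∣ ∎
  where open ≡-Reasoning

∑-*-𝟙-≟ : ∀ {N} c (i : Fin N) → ∑[ j < N ] (c * 𝟙 (i ≟ j)) ≡ c
∑-*-𝟙-≟ {N} c i = begin
  ∑[ j < N ] (c * 𝟙 (i ≟ j)) ≡⟨ sym (*-distribˡ-sum c (λ j → 𝟙 (i ≟ j))) ⟩
  c * ∑[ j < N ] 𝟙 (i ≟ j)   ≡⟨ cong (c *_) (∑-𝟙-≟ i) ⟩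
  c * 1                      ≡⟨ ℕP.*-identityʳ c ⟩
  c                          ∎
  where open ≡-Reasoning

pairIn? : ∀ {N} (s : Subset N) i j → Dec (i Subset.∈ s × j Subset.∈ s × i ≢ j)
pairIn? s i j = i ∈? s ×-dec j ∈? s ×-dec ¬? (i ≟ j)

𝟙-∈×∈ : ∀ {N} (s : Subset N) i j →
        𝟙 (i ∈? s ×-dec j ∈? s) ≡ 𝟙 (i ∈? s ×-dec j ∈? s ×-dec ¬? (i ≟ j)) + 𝟙 (i ∈? s) * 𝟙 (i ≟ j)
𝟙-∈×∈ s i j with i ∈? s | j ∈? s | i ≟ j
... | yes _   | yes _   | yes refl = refl
... | yes _   | yes _   | no _     = refl
... | yes i∈s | no  j∉s | yes refl = contradiction i∈s j∉s
... | yes _   | no  _   | no _     = refl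
... | no  _   | _       | _        = refl

∑∑-pairIn : ∀ {N} (s : Subset N) → ∑[ i < N ] ∑[ j < N ] 𝟙 (pairIn? s i j) ≡ ∣ s ∣ * (∣ s ∣ ∸ 1)
∑∑-pairIn {N} s = begin
  D                           ≡⟨ sym (ℕP.m+n∸n≡m D ∣ s ∣) ⟩
  D + ∣ s ∣ ∸ ∣ s ∣           ≡⟨ cong (_∸ ∣ s ∣) (sym squares) ⟩
  ∣ s ∣ * ∣ s ∣ ∸ ∣ s ∣       ≡⟨ cong (∣ s ∣ * ∣ s ∣ ∸_) (sym (ℕP.*-identityʳ ∣ s ∣)) ⟩
  ∣ s ∣ * ∣ s ∣ ∸ ∣ s ∣ * 1   ≡⟨ sym (ℕP.*-distribˡ-∸ ∣ s ∣ ∣ s ∣ 1) ⟩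
  ∣ s ∣ * (∣ s ∣ ∸ 1)         ∎
  where
  open ≡-Reasoning
  D : ℕ
  D = ∑[ i < N ] ∑[ j < N ] 𝟙 (pairIn? s i j)
  diagonal : Fin N → Fin N → ℕ
  diagonal i j = 𝟙 (i ∈? s) * 𝟙 (i ≟ j)
  squares : ∣ s ∣ * ∣ s ∣ ≡ D + ∣ s ∣
  squares = begin
    ∣ s ∣ * ∣ s ∣
      ≡⟨ sym (∑∑-𝟙-× s s) ⟩
    ∑[ i < N ] ∑[ j < N ] 𝟙 (i ∈? s ×-dec j ∈? s)
      ≡⟨ sum-cong-≗ (λ i → trans (sum-cong-≗ (𝟙-∈×∈ s i)) (∑-distrib-+ (λ j → 𝟙 (pairIn? s i j)) (diagonal i))) ⟩
    ∑[ i < N ] (∑[ j < N ] 𝟙 (pairIn? s i j) + ∑[ j < N ] diagonal i j)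
      ≡⟨ ∑-distrib-+ (λ i → ∑[ j < N ] 𝟙 (pairIn? s i j)) (λ i → ∑[ j < N ] diagonal i j) ⟩
    D + ∑[ i < N ] ∑[ j < N ] diagonal i j
      ≡⟨ cong (D +_) (trans (sum-cong-≗ (λ i → ∑-*-𝟙-≟ (𝟙 (i ∈? s)) i)) (sym (∣p∣≡∑𝟙 s))) ⟩
    D + ∣ s ∣ ∎

∣p∣≡1 : ∀ {N} {s : Subset N} {i} → i Subset.∈ s → (∀ {j} → j Subset.∈ s → j ≡ i) → ∣ s ∣ ≡ 1
∣p∣≡1 {s = s} {i} i∈s only-i = trans (cong ∣_∣ (SubsetP.⊆-antisym s⊆⁅i⁆ ⁅i⁆⊆s)) (SubsetP.∣⁅x⁆∣≡1 i)
  where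
  s⊆⁅i⁆ : s Subset.⊆ ⁅ i ⁆
  s⊆⁅i⁆ j∈s = subst (Subset._∈ ⁅ i ⁆) (sym (only-i j∈s)) (SubsetP.x∈⁅x⁆ i)
  ⁅i⁆⊆s : ⁅ i ⁆ Subset.⊆ s
  ⁅i⁆⊆s j∈⁅i⁆ = subst (Subset._∈ s) (sym (SubsetP.x∈⁅y⁆⇒x≡y i j∈⁅i⁆)) i∈s

∣p∣≡suc⇒nonempty : ∀ {N} {s : Subset N} {k} → ∣ s ∣ ≡ suc k → Subset.Nonempty s
∣p∣≡suc⇒nonempty {N} {s} ∣s∣≡1+k with SubsetP.nonempty? s
... | yes nonempty = nonempty
... | no empty     = contradiction (trans (sym (cong ∣_∣ (SubsetP.Empty-unique empty))) ∣s∣≡1+k)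
                                   (λ ∣⊥∣≡1+k → ℕP.0≢1+n (trans (sym (SubsetP.∣⊥∣≡0 N)) ∣⊥∣≡1+k))

elements : ∀ {N} → Subset N → List (Fin N)
elements []            = []
elements (inside  ∷ s) = Fin.zero ∷ List.map Fin.suc (elements s)
elements (outside ∷ s) = List.map Fin.suc (elements s)

∈-elements⁺ : ∀ {N} {s : Subset N} {i} → i Subset.∈ s → i ∈ elements s
∈-elements⁺ {s = inside  ∷ s} Vec.here        = here refl
∈-elements⁺ {s = inside  ∷ s} (Vec.there i∈s) = there (ListMP.∈-map⁺ Fin.suc (∈-elements⁺ i∈s))
∈-elements⁺ {s = outside ∷ s} (Vec.there i∈s) = ListMP.∈-map⁺ Fin.suc (∈-elements⁺ i∈s)

∈-elements⁻ : ∀ {N} (s : Subset N) {i} → i ∈ elements s → i Subset.∈ s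
∈-elements⁻ (inside ∷ s) (here refl) = Vec.here
∈-elements⁻ (inside ∷ s) (there i∈) with ListMP.∈-map⁻ Fin.suc i∈
... | j , j∈ , refl = Vec.there (∈-elements⁻ s j∈)
∈-elements⁻ (outside ∷ s) i∈ with ListMP.∈-map⁻ Fin.suc i∈
... | j , j∈ , refl = Vec.there (∈-elements⁻ s j∈)

elements-unique : ∀ {N} (s : Subset N) → Unique (elements s)
elements-unique []            = AllPairs.[]
elements-unique (inside  ∷ s) =
  All.tabulate (λ x∈ 0≡x → let _ , _ , x≡1+j = ListMP.∈-map⁻ Fin.suc x∈ in FinP.0≢1+n (trans 0≡x x≡1+j))
  AllPairs.∷ UniqueP.map⁺ FinP.suc-injective (elements-unique s)
elements-unique (outside ∷ s) = UniqueP.map⁺ FinP.suc-injective (elements-unique s)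

length-elements : ∀ {N} (s : Subset N) → length (elements s) ≡ ∣ s ∣
length-elements []            = refl
length-elements (inside  ∷ s) = cong suc (trans (ListP.length-map Fin.suc (elements s)) (length-elements s))
length-elements (outside ∷ s) = trans (ListP.length-map Fin.suc (elements s)) (length-elements s)

-- Double counting

∑ᴸ : ∀ {B : Set} → List B → (B → ℕ) → ℕ
∑ᴸ bs f = sum (List.map f bs)

∑ᴸ-const : ∀ {B : Set} (bs : List B) c → ∑ᴸ bs (λ _ → c) ≡ length bs * c
∑ᴸ-const []       c = refl
∑ᴸ-const (b ∷ bs) c = cong (c +_) (∑ᴸ-const bs c)

∑ᴸ-cong : ∀ {B : Set} (bs : List B) {f g : B → ℕ} → (∀ {b} → b ∈ bs → f b ≡ g b) → ∑ᴸ bs f ≡ ∑ᴸ bs g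
∑ᴸ-cong []       f≡g = refl
∑ᴸ-cong (b ∷ bs) f≡g = cong₂ _+_ (f≡g (here refl)) (∑ᴸ-cong bs (f≡g ∘ there))

∑ᴸ-∑ : ∀ {B : Set} {N} (bs : List B) (f : B → Fin N → ℕ) →
       ∑ᴸ bs (λ b → ∑[ i < N ] f b i) ≡ ∑[ i < N ] ∑ᴸ bs (λ b → f b i)
∑ᴸ-∑ {N = N} []       f = sym (sum-replicate-zero N)
∑ᴸ-∑ {N = N} (b ∷ bs) f = trans (cong (∑[ i < N ] f b i +_) (∑ᴸ-∑ bs f))
                                (sym (∑-distrib-+ (f b) (λ i → ∑ᴸ bs (λ b′ → f b′ i))))

module _ {B : Set} {P : B → Set} (P? : ∀ b → Dec (P b)) where

  ∑ᴸ-𝟙-none : ∀ bs → (∀ {b} → b ∈ bs → ¬ P b) → ∑ᴸ bs (𝟙 ∘ P?) ≡ 0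
  ∑ᴸ-𝟙-none []       ¬P = refl
  ∑ᴸ-𝟙-none (b ∷ bs) ¬P = cong₂ _+_ (𝟙-no (P? b) (¬P (here refl))) (∑ᴸ-𝟙-none bs (¬P ∘ there))

  ∑ᴸ-𝟙-unique : ∀ {bs b} → Unique bs → b ∈ bs → P b →
                (∀ {b b′} → b ∈ bs → b′ ∈ bs → P b → P b′ → b ≡ b′) → ∑ᴸ bs (𝟙 ∘ P?) ≡ 1
  ∑ᴸ-𝟙-unique {b₀ ∷ bs} (b₀∉bs AllPairs.∷ uniq) (here refl) Pb unique =
    cong₂ _+_ (𝟙-yes (P? b₀) Pb) (∑ᴸ-𝟙-none bs (λ b∈bs Pb′ →
      All.lookup b₀∉bs b∈bs (unique (here refl) (there b∈bs) Pb Pb′)))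
  ∑ᴸ-𝟙-unique {b₀ ∷ bs} (b₀∉bs AllPairs.∷ uniq) (there b∈bs) Pb unique =
    cong₂ _+_ (𝟙-no (P? b₀) (λ Pb₀ → All.lookup b₀∉bs b∈bs (unique (here refl) (there b∈bs) Pb₀ Pb)))
              (∑ᴸ-𝟙-unique uniq b∈bs Pb (λ b∈ b′∈ → unique (there b∈) (there b′∈)))

double-counting :
  ∀ {B : Set} {N} {Inc : B → Fin N → Fin N → Set} {Q : Fin N → Fin N → Set}
  (inc? : ∀ b i j → Dec (Inc b i j)) (q? : ∀ i j → Dec (Q i j)) (bs : List B) → Unique bs →
  (∀ {b i j} → b ∈ bs → Inc b i j → Q i j) →
  (∀ {i j} → Q i j → ∃ λ b → b ∈ bs × Inc b i j) →
  (∀ {b b′ i j} → b ∈ bs → b′ ∈ bs → Inc b i j → Inc b′ i j → b ≡ b′) →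
  ∑ᴸ bs (λ b → ∑[ i < N ] ∑[ j < N ] 𝟙 (inc? b i j)) ≡ ∑[ i < N ] ∑[ j < N ] 𝟙 (q? i j)
double-counting {N = N} inc? q? bs uniq sound cover unique = begin
  ∑ᴸ bs (λ b → ∑[ i < N ] ∑[ j < N ] 𝟙 (inc? b i j))  ≡⟨ ∑ᴸ-∑ bs (λ b i → ∑[ j < N ] 𝟙 (inc? b i j)) ⟩
  ∑[ i < N ] ∑ᴸ bs (λ b → ∑[ j < N ] 𝟙 (inc? b i j))  ≡⟨ sum-cong-≗ (λ i → ∑ᴸ-∑ bs (λ b j → 𝟙 (inc? b i j))) ⟩
  ∑[ i < N ] ∑[ j < N ] ∑ᴸ bs (λ b → 𝟙 (inc? b i j))  ≡⟨ sum-cong-≗ (λ i → sum-cong-≗ (blocksThrough i)) ⟩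
  ∑[ i < N ] ∑[ j < N ] 𝟙 (q? i j)                     ∎
  where
  open ≡-Reasoning
  blocksThrough : ∀ i j → ∑ᴸ bs (λ b → 𝟙 (inc? b i j)) ≡ 𝟙 (q? i j)
  blocksThrough i j with q? i j
  ... | no ¬q = ∑ᴸ-𝟙-none (λ b → inc? b i j) bs (λ b∈bs → ¬q ∘ sound b∈bs)
  ... | yes q = let b , b∈bs , inc = cover q in
                ∑ᴸ-𝟙-unique (λ b → inc? b i j) uniq b∈bs inc unique

sts-size : ∀ {N} {P : Subset N} {bs : List (Subset N)} → IsSTS P bs → length bs * 6 ≡ ∣ P ∣ * (∣ P ∣ ∸ 1)
sts-size {N} {P} {bs} (uniq , blocks , cover , unique) = begin
  length bs * 6                                            ≡⟨ sym (∑ᴸ-const bs 6) ⟩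
  ∑ᴸ bs (λ _ → 6)                                          ≡⟨ ∑ᴸ-cong bs pairsInBlock ⟩
  ∑ᴸ bs (λ b → ∑[ i < N ] ∑[ j < N ] 𝟙 (pairIn? b i j))   ≡⟨ double-counting pairIn? (pairIn? P) bs uniq sound cover′ unique′ ⟩
  ∑[ i < N ] ∑[ j < N ] 𝟙 (pairIn? P i j)                 ≡⟨ ∑∑-pairIn P ⟩
  ∣ P ∣ * (∣ P ∣ ∸ 1)                                      ∎
  where
  open ≡-Reasoning
  pairsInBlock : ∀ {b} → b ∈ bs → 6 ≡ ∑[ i < N ] ∑[ j < N ] 𝟙 (pairIn? b i j)
  pairsInBlock {b} b∈bs = sym (trans (∑∑-pairIn b) (cong (λ k → k * (k ∸ 1)) (proj₁ (blocks b b∈bs))))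
  sound : ∀ {b i j} → b ∈ bs → i Subset.∈ b × j Subset.∈ b × i ≢ j → i Subset.∈ P × j Subset.∈ P × i ≢ j
  sound b∈bs (i∈b , j∈b , i≢j) = proj₂ (blocks _ b∈bs) i∈b , proj₂ (blocks _ b∈bs) j∈b , i≢j
  cover′ : ∀ {i j} → i Subset.∈ P × j Subset.∈ P × i ≢ j →
           ∃ λ b → b ∈ bs × i Subset.∈ b × j Subset.∈ b × i ≢ j
  cover′ (i∈P , j∈P , i≢j) = let b , b∈bs , i∈b , j∈b = cover _ _ i∈P j∈P i≢j in b , b∈bs , i∈b , j∈b , i≢j
  unique′ : ∀ {b b′ i j} → b ∈ bs → b′ ∈ bs →
            i Subset.∈ b × j Subset.∈ b × i ≢ j → i Subset.∈ b′ × j Subset.∈ b′ × i ≢ j → b ≡ b′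
  unique′ b∈ b′∈ (i∈b , j∈b , i≢j) (i∈b′ , j∈b′ , _) = unique _ _ i≢j _ _ b∈ b′∈ i∈b j∈b i∈b′ j∈b′

td-size : ∀ {N} {G₁ G₂ G₃ : Subset N} {g} {bs : List (Subset N)} → IsTD G₁ G₂ G₃ g bs → length bs ≡ g * g
td-size {N} {G₁} {G₂} {G₃} {g} {bs} (∣G₁∣ , ∣G₂∣ , _ , _ , _ , _ , uniq , blocks , cover , unique) = begin
  length bs                                             ≡⟨ sym (ℕP.*-identityʳ _) ⟩
  length bs * 1                                         ≡⟨ sym (∑ᴸ-const bs 1) ⟩
  ∑ᴸ bs (λ _ → 1)                                       ≡⟨ ∑ᴸ-cong bs transversalPairs ⟩
  ∑ᴸ bs (λ b → ∑[ i < N ] ∑[ j < N ] 𝟙 (inc? b i j))   ≡⟨ double-counting inc? q? bs uniq sound cover′ unique′ ⟩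
  ∑[ i < N ] ∑[ j < N ] 𝟙 (q? i j)                      ≡⟨ ∑∑-𝟙-× G₁ G₂ ⟩
  ∣ G₁ ∣ * ∣ G₂ ∣                                       ≡⟨ cong₂ _*_ ∣G₁∣ ∣G₂∣ ⟩
  g * g                                                 ∎
  where
  open ≡-Reasoning
  inc? : ∀ b i j → Dec (i Subset.∈ b ∩ G₁ × j Subset.∈ b ∩ G₂)
  inc? b i j = i ∈? b ∩ G₁ ×-dec j ∈? b ∩ G₂
  q? : ∀ i j → Dec (i Subset.∈ G₁ × j Subset.∈ G₂)
  q? i j = i ∈? G₁ ×-dec j ∈? G₂
  transversalPairs : ∀ {b} → b ∈ bs → 1 ≡ ∑[ i < N ] ∑[ j < N ] 𝟙 (inc? b i j)
  transversalPairs {b} b∈bs = let _ , ∣b∩G₁∣ , ∣b∩G₂∣ , _ = blocks b b∈bs in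
    sym (trans (∑∑-𝟙-× (b ∩ G₁) (b ∩ G₂)) (cong₂ _*_ ∣b∩G₁∣ ∣b∩G₂∣))
  sound : ∀ {b i j} → b ∈ bs → i Subset.∈ b ∩ G₁ × j Subset.∈ b ∩ G₂ → i Subset.∈ G₁ × j Subset.∈ G₂
  sound {b} _ (i∈ , j∈) = proj₂ (SubsetP.x∈p∩q⁻ b G₁ i∈) , proj₂ (SubsetP.x∈p∩q⁻ b G₂ j∈)
  cover′ : ∀ {i j} → i Subset.∈ G₁ × j Subset.∈ G₂ → ∃ λ b → b ∈ bs × i Subset.∈ b ∩ G₁ × j Subset.∈ b ∩ G₂
  cover′ {i} {j} (i∈G₁ , j∈G₂) = let b , b∈bs , i∈b , j∈b = cover i j (inj₁ (i∈G₁ , j∈G₂)) in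
    b , b∈bs , SubsetP.x∈p∩q⁺ (i∈b , i∈G₁) , SubsetP.x∈p∩q⁺ (j∈b , j∈G₂)
  unique′ : ∀ {b b′ i j} → b ∈ bs → b′ ∈ bs →
            i Subset.∈ b ∩ G₁ × j Subset.∈ b ∩ G₂ → i Subset.∈ b′ ∩ G₁ × j Subset.∈ b′ ∩ G₂ → b ≡ b′
  unique′ {b} {b′} {i} {j} b∈ b′∈ (i∈b∩G₁ , j∈b∩G₂) (i∈b′∩G₁ , j∈b′∩G₂) =
    let i∈b , i∈G₁ = SubsetP.x∈p∩q⁻ b G₁ i∈b∩G₁
        j∈b , j∈G₂ = SubsetP.x∈p∩q⁻ b G₂ j∈b∩G₂ in
    unique i j (inj₁ (i∈G₁ , j∈G₂)) b b′ b∈ b′∈ i∈b j∈b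
      (proj₁ (SubsetP.x∈p∩q⁻ b′ G₁ i∈b′∩G₁)) (proj₁ (SubsetP.x∈p∩q⁻ b′ G₂ j∈b′∩G₂))

∑ⱽ : ∀ n → (Vec F3 n → ℕ) → ℕ
∑ⱽ zero    h = h []
∑ⱽ (suc n) h = ∑[ a < 3 ] ∑ⱽ n (λ v → h (a ∷ v))

∑ⱽ-cong : ∀ n {h h′ : Vec F3 n → ℕ} → (∀ v → h v ≡ h′ v) → ∑ⱽ n h ≡ ∑ⱽ n h′
∑ⱽ-cong zero    h≡h′ = h≡h′ []
∑ⱽ-cong (suc n) h≡h′ = sum-cong-≗ (λ a → ∑ⱽ-cong n (λ v → h≡h′ (a ∷ v)))

∑ⱽ-*ˡ : ∀ n c (h : Vec F3 n → ℕ) → ∑ⱽ n (λ v → c * h v) ≡ c * ∑ⱽ n h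
∑ⱽ-*ˡ zero    c h = refl
∑ⱽ-*ˡ (suc n) c h = trans (sum-cong-≗ (λ a → ∑ⱽ-*ˡ n c (λ v → h (a ∷ v))))
                          (sym (*-distribˡ-sum c (λ a → ∑ⱽ n (λ v → h (a ∷ v)))))

∑ⱽ-1 : ∀ n → ∑ⱽ n (λ _ → 1) ≡ 3 ^ n
∑ⱽ-1 zero    = refl
∑ⱽ-1 (suc n) = cong (λ k → k + (k + (k + 0))) (∑ⱽ-1 n)

decode : ∀ {n} → Fin (3 ^ n) → Vec F3 n
decode k = tabulate (finToFun k)

decode-funToFin : ∀ {n} (v : Vec F3 n) → decode (funToFin (lookup v)) ≡ v
decode-funToFin v = trans (VecP.tabulate-cong (FinP.finToFun-funToFin (lookup v))) (VecP.tabulate∘lookup v)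

decode-combine : ∀ {n} a (k : Fin (3 ^ n)) → decode {suc n} (combine a k) ≡ a ∷ decode k
decode-combine {n} a k = cong (λ (a , k) → a ∷ decode k) (FinP.remQuot-combine {k = 3 ^ n} a k)

∑-decode : ∀ n (h : Vec F3 n → ℕ) → ∑[ k < 3 ^ n ] h (decode k) ≡ ∑ⱽ n h
∑-decode zero    h = ℕP.+-identityʳ (h [])
∑-decode (suc n) h = trans (∑-combine 3 (3 ^ n) (h ∘ decode))
  (sum-cong-≗ λ a → trans (sum-cong-≗ (λ k → cong h (decode-combine a k))) (∑-decode n (λ v → h (a ∷ v))))

∑-injective≡∑ⱽ : ∀ n (cols : Fin (3 ^ n) → Vec F3 n) → Injective _≡_ _≡_ cols →
                   (h : Vec F3 n → ℕ) → ∑[ i < 3 ^ n ] h (cols i) ≡ ∑ⱽ n h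
∑-injective≡∑ⱽ n cols cols-inj h = begin
  ∑[ i < 3 ^ n ] h (cols i)                   ≡⟨ sum-cong-≗ (λ i → cong h (sym (decode-funToFin (cols i)))) ⟩
  ∑[ i < 3 ^ n ] h (decode (encode (cols i))) ≡⟨ ∑-reindex (encode ∘ cols) encode∘cols-injective (h ∘ decode) ⟩
  ∑[ k < 3 ^ n ] h (decode k)                 ≡⟨ ∑-decode n h ⟩
  ∑ⱽ n h                                      ∎
  where
  open ≡-Reasoning
  encode : Vec F3 n → Fin (3 ^ n)
  encode v = funToFin (lookup v)
  encode∘cols-injective : Injective _≡_ _≡_ (encode ∘ cols)
  encode∘cols-injective {i} {j} eq =
    cols-inj (trans (sym (decode-funToFin (cols i))) (trans (cong decode eq) (decode-funToFin (cols j))))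

infix 4 _≟ⱽ_
_≟ⱽ_ : ∀ {k} (v w : Vec F3 k) → Dec (v ≡ w)
_≟ⱽ_ = VecP.≡-dec _≟_

𝟙-∷ : ∀ {k} a b (v w : Vec F3 k) → 𝟙 (a ∷ v ≟ⱽ b ∷ w) ≡ 𝟙 (a ≟ b) * 𝟙 (v ≟ⱽ w)
𝟙-∷ a b v w = trans (𝟙-cong (a ∷ v ≟ⱽ b ∷ w) (a ≟ b ×-dec v ≟ⱽ w) VecP.∷-injective (λ (a≡b , v≡w) → cong₂ _∷_ a≡b v≡w))
                    (𝟙-× (a ≟ b) (v ≟ⱽ w))

project : ∀ {m n} → (Fin m → Fin n) → Vec F3 n → Vec F3 m
project keep v = tabulate (λ r → lookup v (keep r))

StrictlyMonotone : ∀ {m n} → (Fin m → Fin n) → Set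
StrictlyMonotone f = f Preserves Fin._<_ ⟶ Fin._<_

strictlyMonotone⇒injective : ∀ {m n} {f : Fin m → Fin n} → StrictlyMonotone f → Injective _≡_ _≡_ f
strictlyMonotone⇒injective {f = f} mono {r} {s} fr≡fs with FinP.<-cmp r s
... | tri< r<s _ _ = contradiction (cong toℕ fr≡fs) (ℕP.<⇒≢ (mono r<s))
... | tri≈ _ r≡s _ = r≡s
... | tri> _ _ s<r = contradiction (cong toℕ (sym fr≡fs)) (ℕP.<⇒≢ (mono s<r))

above⇒≢zero : ∀ {n} {i j : Fin (suc n)} → i Fin.< j → Fin.zero ≢ j
above⇒≢zero i<j refl = ℕP.n≮0 i<j

module _ {m n} (f : Fin m → Fin (suc n)) (f≢0 : ∀ r → Fin.zero ≢ f r) where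

  shiftDown : Fin m → Fin n
  shiftDown r = punchOut (f≢0 r)

  suc∘shiftDown : ∀ r → Fin.suc (shiftDown r) ≡ f r
  suc∘shiftDown r = FinP.punchIn-punchOut (f≢0 r)

  shiftDown-mono : StrictlyMonotone f → StrictlyMonotone shiftDown
  shiftDown-mono mono {r} {s} r<s =
    ℕ.s<s⁻¹ (subst₂ Fin._<_ (sym (suc∘shiftDown r)) (sym (suc∘shiftDown s)) (mono r<s))

  project-shiftDown : ∀ a v → project f (a ∷ v) ≡ project shiftDown v
  project-shiftDown a v = VecP.tabulate-cong (λ r → cong (lookup (a ∷ v)) (sym (suc∘shiftDown r)))

∑ⱽ-fibre : ∀ n {m} (keep : Fin m → Fin n) → StrictlyMonotone keep → (u : Vec F3 m) →
           ∑ⱽ n (λ v → 𝟙 (u ≟ⱽ project keep v)) ≡ 3 ^ (n ∸ m)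
∑ⱽ-fibre n       {zero}  keep mono [] = ∑ⱽ-1 n
∑ⱽ-fibre zero    {suc m} keep mono u  = contradiction (keep Fin.zero) λ ()
∑ⱽ-fibre (suc n) {suc m} keep mono (u₀ ∷ u) with keep Fin.zero ≟ Fin.zero
... | yes keep0≡0 = begin
  ∑[ a < 3 ] ∑ⱽ n (λ v → 𝟙 (u₀ ∷ u ≟ⱽ project keep (a ∷ v)))
    ≡⟨ sum-cong-≗ (λ a → ∑ⱽ-cong n (λ v → trans (cong (λ w → 𝟙 (u₀ ∷ u ≟ⱽ w)) (project-∷ a v))
                                                (𝟙-∷ u₀ a u (project keep′ v)))) ⟩
  ∑[ a < 3 ] ∑ⱽ n (λ v → 𝟙 (u₀ ≟ a) * 𝟙 (u ≟ⱽ project keep′ v))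
    ≡⟨ sum-cong-≗ (λ a → ∑ⱽ-*ˡ n (𝟙 (u₀ ≟ a)) (λ v → 𝟙 (u ≟ⱽ project keep′ v))) ⟩
  ∑[ a < 3 ] (𝟙 (u₀ ≟ a) * ∑ⱽ n (λ v → 𝟙 (u ≟ⱽ project keep′ v)))
    ≡⟨ ∑-*ʳ 3 (λ a → 𝟙 (u₀ ≟ a)) _ ⟩
  (∑[ a < 3 ] 𝟙 (u₀ ≟ a)) * ∑ⱽ n (λ v → 𝟙 (u ≟ⱽ project keep′ v))
    ≡⟨ cong₂ _*_ (∑-𝟙-≟ u₀) (∑ⱽ-fibre n keep′ (shiftDown-mono (keep ∘ Fin.suc) tail≢0 (mono ∘ s≤s)) u) ⟩
  1 * 3 ^ (n ∸ m)
    ≡⟨ ℕP.*-identityˡ _ ⟩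
  3 ^ (n ∸ m) ∎
  where
  open ≡-Reasoning
  tail≢0 : ∀ r → Fin.zero ≢ keep (Fin.suc r)
  tail≢0 r = above⇒≢zero (mono {Fin.zero} {Fin.suc r} (s≤s z≤n))
  keep′ : Fin m → Fin n
  keep′ = shiftDown (keep ∘ Fin.suc) tail≢0
  project-∷ : ∀ a v → project keep (a ∷ v) ≡ a ∷ project keep′ v
  project-∷ a v = cong₂ _∷_ (cong (lookup (a ∷ v)) keep0≡0) (project-shiftDown (keep ∘ Fin.suc) tail≢0 a v)
... | no keep0≢0 = begin
  ∑[ a < 3 ] ∑ⱽ n (λ v → 𝟙 (u₀ ∷ u ≟ⱽ project keep (a ∷ v)))
    ≡⟨ sum-cong-≗ (λ a → ∑ⱽ-cong n (λ v → cong (λ w → 𝟙 (u₀ ∷ u ≟ⱽ w)) (project-shiftDown keep all≢0 a v))) ⟩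
  ∑[ a < 3 ] ∑ⱽ n (λ v → 𝟙 (u₀ ∷ u ≟ⱽ project keep′ v))
    ≡⟨ sum-cong-≗ {n = 3} (λ _ → ∑ⱽ-fibre n keep′ (shiftDown-mono keep all≢0 mono) (u₀ ∷ u)) ⟩
  ∑[ a < 3 ] (3 ^ (n ∸ suc m))
    ≡⟨⟩
  3 * 3 ^ (n ∸ suc m)
    ≡⟨ cong (3 ^_) (sym (ℕP.+-∸-assoc 1 m<n)) ⟩
  3 ^ (n ∸ m) ∎
  where
  open ≡-Reasoning
  all≢0 : ∀ r → Fin.zero ≢ keep r
  all≢0 Fin.zero    = keep0≢0 ∘ sym
  all≢0 (Fin.suc r) = above⇒≢zero (mono {Fin.zero} {Fin.suc r} (s≤s z≤n))
  keep′ : Fin (suc m) → Fin n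
  keep′ = shiftDown keep all≢0
  m<n : suc m ≤ n
  m<n = FinP.injective⇒≤ (strictlyMonotone⇒injective (shiftDown-mono keep all≢0 mono))

+₃-assoc : ∀ x y z → (x +₃ y) +₃ z ≡ x +₃ (y +₃ z)
+₃-assoc = from-yes (all? λ x → all? λ y → all? λ z → (x +₃ y) +₃ z ≟ x +₃ (y +₃ z))

+₃-comm : ∀ x y → x +₃ y ≡ y +₃ x
+₃-comm = from-yes (all? λ x → all? λ y → x +₃ y ≟ y +₃ x)

+₃-identityˡ : ∀ x → 0₃ +₃ x ≡ x
+₃-identityˡ = from-yes (all? λ x → 0₃ +₃ x ≟ x)

+₃-identityʳ : ∀ x → x +₃ 0₃ ≡ x
+₃-identityʳ x = trans (+₃-comm x 0₃) (+₃-identityˡ x)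

x+x+x≡0 : ∀ x → (x +₃ x) +₃ x ≡ 0₃
x+x+x≡0 = from-yes (all? λ x → (x +₃ x) +₃ x ≟ 0₃)

*₃-identityʳ : ∀ x → x *₃ 1₃ ≡ x
*₃-identityʳ = from-yes (all? λ x → x *₃ 1₃ ≟ x)

*₃-zeroʳ : ∀ x → x *₃ 0₃ ≡ 0₃
*₃-zeroʳ = from-yes (all? λ x → x *₃ 0₃ ≟ 0₃)

-- In AG(m,3), a + b + c = 0 holds exactly when a = b = c or {a, b, c} is a line.
Collinear : ∀ {m} → Vec F3 m → Vec F3 m → Vec F3 m → Set
Collinear {m} a b c = (a +V b) +V c ≡ zeroV m

collinear-self : ∀ {m} (a : Vec F3 m) → Collinear a a a
collinear-self []      = refl
collinear-self (x ∷ a) = cong₂ _∷_ (x+x+x≡0 x) (collinear-self a)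

collinear-pointwise : ∀ {m} {a b c : Vec F3 m} → (∀ ρ → (lookup a ρ +₃ lookup b ρ) +₃ lookup c ρ ≡ 0₃) →
                      Collinear a b c
collinear-pointwise {a = []}    {[]}    {[]}    _   = refl
collinear-pointwise {a = _ ∷ _} {_ ∷ _} {_ ∷ _} abc = cong₂ _∷_ (abc Fin.zero) (collinear-pointwise (abc ∘ Fin.suc))

-- In characteristic 3, -a = a + a.
-ᵛ_ : ∀ {m} → Vec F3 m → Vec F3 m
-ᵛ a = a +V a

+ᵛ-isAbelianGroup : ∀ m → IsAbelianGroup _≡_ (_+V_ {m}) (zeroV m) -ᵛ_
+ᵛ-isAbelianGroup m = record
  { isGroup = record
    { isMonoid = record
      { isSemigroup = record
        { isMagma = record { isEquivalence = isEquivalence ; ∙-cong = cong₂ _+V_ }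
        ; assoc = VecP.zipWith-assoc +₃-assoc
        }
      ; identity = VecP.zipWith-identityˡ +₃-identityˡ
                 , VecP.zipWith-identityʳ +₃-identityʳ
      }
    ; inverse = collinear-self , λ a → trans (VecP.zipWith-comm +₃-comm a (a +V a)) (collinear-self a)
    ; ⁻¹-cong = cong -ᵛ_
    }
  ; comm = VecP.zipWith-comm +₃-comm
  }

+ᵛ-abelianGroup : ℕ → AbelianGroup 0ℓ 0ℓ
+ᵛ-abelianGroup m = record { isAbelianGroup = +ᵛ-isAbelianGroup m }

module _ {m : ℕ} where
  open AbelianGroup (+ᵛ-abelianGroup m) using (commutativeSemigroup)
  open import Algebra.Properties.AbelianGroup (+ᵛ-abelianGroup m) using (inverseʳ-unique)
  open import Algebra.Properties.CommutativeSemigroup commutativeSemigroup using (xy∙z≈yx∙z; xy∙z≈xz∙y)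

  collinear-swap₁₂ : ∀ {a b c : Vec F3 m} → Collinear a b c → Collinear b a c
  collinear-swap₁₂ {a} {b} {c} abc = trans (xy∙z≈yx∙z b a c) abc

  collinear-swap₂₃ : ∀ {a b c : Vec F3 m} → Collinear a b c → Collinear a c b
  collinear-swap₂₃ {a} {b} {c} abc = trans (xy∙z≈xz∙y a c b) abc

  collinear-unique : ∀ {a b c d : Vec F3 m} → Collinear a b c → Collinear a b d → c ≡ d
  collinear-unique {a} {b} {c} {d} abc abd =
    trans (inverseʳ-unique (a +V b) c abc) (sym (inverseʳ-unique (a +V b) d abd))

  collinear-diagonal : ∀ (a : Vec F3 m) {c} → Collinear a a c → c ≡ a
  collinear-diagonal a aac = collinear-unique aac (collinear-self a)

  isLine-swap₁₂ : ∀ {a b c : Vec F3 m} → IsLine a b c → IsLine b a c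
  isLine-swap₁₂ (a≢b , a≢c , b≢c , abc) = a≢b ∘ sym , b≢c , a≢c , collinear-swap₁₂ abc

  isLine-swap₂₃ : ∀ {a b c : Vec F3 m} → IsLine a b c → IsLine a c b
  isLine-swap₂₃ (a≢b , a≢c , b≢c , abc) = a≢c , a≢b , b≢c ∘ sym , collinear-swap₂₃ abc

  collinear⇒isLine : ∀ {a b c : Vec F3 m} → Collinear a b c → a ≢ b → IsLine a b c
  collinear⇒isLine {a} {b} {c} abc a≢b = a≢b , a≢c , b≢c , abc
    where
    a≢c : a ≢ c
    a≢c refl = a≢b (sym (collinear-diagonal a (collinear-swap₂₃ abc)))
    b≢c : b ≢ c
    b≢c refl = a≢b (collinear-diagonal b (collinear-swap₂₃ (collinear-swap₁₂ abc)))

-- Blocks of D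

record IsTriple {N} (s : Subset N) (p q r : Fin N) : Set where
  field
    p≢q : p ≢ q
    p≢r : p ≢ r
    q≢r : q ≢ r
    p∈s : p Subset.∈ s
    q∈s : q Subset.∈ s
    r∈s : r Subset.∈ s
    ∈-cases : ∀ {y} → y Subset.∈ s → y ≡ p ⊎ y ≡ q ⊎ y ≡ r

isTriple-swap₁₂ : ∀ {N} {s : Subset N} {p q r} → IsTriple s p q r → IsTriple s q p r
isTriple-swap₁₂ t = record
  { p≢q = p≢q ∘ sym ; p≢r = q≢r ; q≢r = p≢r ; p∈s = q∈s ; q∈s = p∈s ; r∈s = r∈s
  ; ∈-cases = [ inj₂ ∘ inj₁ , [ inj₁ , inj₂ ∘ inj₂ ]′ ]′ ∘ ∈-cases }
  where open IsTriple t

isTriple-swap₂₃ : ∀ {N} {s : Subset N} {p q r} → IsTriple s p q r → IsTriple s p r q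
isTriple-swap₂₃ t = record
  { p≢q = p≢r ; p≢r = p≢q ; q≢r = q≢r ∘ sym ; p∈s = p∈s ; q∈s = r∈s ; r∈s = q∈s
  ; ∈-cases = map₂ swap ∘ ∈-cases }
  where open IsTriple t

ZeroSumTriple : ∀ {N m} → (Fin N → Vec F3 m) → Subset N → Fin N → Fin N → Fin N → Set
ZeroSumTriple col s p q r = IsTriple s p q r × Collinear (col p) (col q) (col r)

module _ {N m} {col : Fin N → Vec F3 m} {s : Subset N} where

  zeroSumTriple-swap₁₂ : ∀ {p q r} → ZeroSumTriple col s p q r → ZeroSumTriple col s q p r
  zeroSumTriple-swap₁₂ (t , pqr) = isTriple-swap₁₂ t , collinear-swap₁₂ pqr

  zeroSumTriple-swap₂₃ : ∀ {p q r} → ZeroSumTriple col s p q r → ZeroSumTriple col s p r q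
  zeroSumTriple-swap₂₃ (t , pqr) = isTriple-swap₂₃ t , collinear-swap₂₃ pqr

  completeTriple : ∀ {p q r i j} → ZeroSumTriple col s p q r →
                   i Subset.∈ s → j Subset.∈ s → i ≢ j → ∃ λ k → ZeroSumTriple col s i j k
  completeTriple {p} {q} {r} {i} {j} pqr i∈s j∈s i≢j
    with IsTriple.∈-cases (proj₁ pqr) i∈s | IsTriple.∈-cases (proj₁ pqr) j∈s
  ... | inj₁ refl        | inj₁ refl        = contradiction refl i≢j
  ... | inj₁ refl        | inj₂ (inj₁ refl) = r , pqr
  ... | inj₁ refl        | inj₂ (inj₂ refl) = q , zeroSumTriple-swap₂₃ pqr
  ... | inj₂ (inj₁ refl) | inj₁ refl        = r , zeroSumTriple-swap₁₂ pqr
  ... | inj₂ (inj₁ refl) | inj₂ (inj₁ refl) = contradiction refl i≢j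
  ... | inj₂ (inj₁ refl) | inj₂ (inj₂ refl) = p , zeroSumTriple-swap₂₃ (zeroSumTriple-swap₁₂ pqr)
  ... | inj₂ (inj₂ refl) | inj₁ refl        = q , zeroSumTriple-swap₁₂ (zeroSumTriple-swap₂₃ pqr)
  ... | inj₂ (inj₂ refl) | inj₂ (inj₁ refl) = p , zeroSumTriple-swap₁₂ (zeroSumTriple-swap₂₃ (zeroSumTriple-swap₁₂ pqr))
  ... | inj₂ (inj₂ refl) | inj₂ (inj₂ refl) = contradiction refl i≢j

∑₃ : List F3 → F3
∑₃ = List.foldr _+₃_ 0₃

dot-indicator : ∀ {N} (v : Vec F3 N) (s : Subset N) → dot v (indicator s) ≡ ∑₃ (List.map (lookup v) (elements s))
dot-indicator []      []            = refl
dot-indicator (x ∷ v) (inside  ∷ s) = cong₂ _+₃_ (*₃-identityʳ x) (trans (dot-indicator v s)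
  (cong ∑₃ (ListP.map-∘ {g = lookup (x ∷ v)} {f = Fin.suc} (elements s))))
dot-indicator (x ∷ v) (outside ∷ s) = trans (cong₂ _+₃_ (*₃-zeroʳ x) (dot-indicator v s))
  (trans (+₃-identityˡ _) (cong ∑₃ (ListP.map-∘ {g = lookup (x ∷ v)} {f = Fin.suc} (elements s))))

dot-indicator-triple : ∀ {N} (v : Vec F3 N) {s : Subset N} {p q r} → elements s ≡ p ∷ q ∷ r ∷ [] →
                       dot v (indicator s) ≡ (lookup v p +₃ lookup v q) +₃ lookup v r
dot-indicator-triple v {s} {p} {q} {r} elements≡ = begin
  dot v (indicator s)                              ≡⟨ dot-indicator v s ⟩
  ∑₃ (List.map (lookup v) (elements s))            ≡⟨ cong (∑₃ ∘ List.map (lookup v)) elements≡ ⟩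
  lookup v p +₃ (lookup v q +₃ (lookup v r +₃ 0₃)) ≡⟨ cong (λ z → lookup v p +₃ (lookup v q +₃ z)) (+₃-identityʳ (lookup v r)) ⟩
  lookup v p +₃ (lookup v q +₃ lookup v r)         ≡⟨ sym (+₃-assoc (lookup v p) (lookup v q) (lookup v r)) ⟩
  (lookup v p +₃ lookup v q) +₃ lookup v r         ∎
  where open ≡-Reasoning

length≡3 : ∀ {A : Set} (xs : List A) → length xs ≡ 3 → ∃₂ λ p q → ∃ λ r → xs ≡ p ∷ q ∷ r ∷ []
length≡3 (p ∷ q ∷ r ∷ []) refl = p , q , r , refl

elements≡⇒isTriple : ∀ {N} {s : Subset N} {p q r} → elements s ≡ p ∷ q ∷ r ∷ [] → IsTriple s p q r
elements≡⇒isTriple {s = s} {p} {q} {r} elements≡ with subst Unique elements≡ (elements-unique s)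
... | (p≢q All.∷ p≢r All.∷ All.[]) AllPairs.∷ (q≢r All.∷ All.[]) AllPairs.∷ _ = record
  { p≢q = p≢q ; p≢r = p≢r ; q≢r = q≢r
  ; p∈s = member (here refl) ; q∈s = member (there (here refl)) ; r∈s = member (there (there (here refl)))
  ; ∈-cases = cases ∘ subst (_ ∈_) elements≡ ∘ ∈-elements⁺ }
  where
  member : ∀ {y} → y ∈ p ∷ q ∷ r ∷ [] → y Subset.∈ s
  member y∈ = ∈-elements⁻ s (subst (_ ∈_) (sym elements≡) y∈)
  cases : ∀ {y} → y ∈ p ∷ q ∷ r ∷ [] → y ≡ p ⊎ y ≡ q ⊎ y ≡ r
  cases (here y≡p)                 = inj₁ y≡p
  cases (there (here y≡q))         = inj₂ (inj₁ y≡q)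
  cases (there (there (here y≡r))) = inj₂ (inj₂ y≡r)

lookup-rowB : ∀ {n m} (cols : Fin (3 ^ n) → Vec F3 n) (keep : Fin m → Fin n) ρ i →
              lookup (rowB cols keep ρ) i ≡ lookup (colB cols keep i) ρ
lookup-rowB cols keep ρ i = trans (VecP.lookup∘tabulate _ i) (sym (VecP.lookup∘tabulate _ ρ))

dBlock⇒zeroSumTriple : ∀ {n m} {cols : Fin (3 ^ n) → Vec F3 n} {keep : Fin m → Fin n} {s} →
                       IsDBlock cols keep s → ∃₂ λ p q → ∃ λ r → ZeroSumTriple (colB cols keep) s p q r
dBlock⇒zeroSumTriple {cols = cols} {keep} {s} (∣s∣≡3 , _ , rows)
  with length≡3 (elements s) (trans (length-elements s) ∣s∣≡3)
... | p , q , r , elements≡ = p , q , r , elements≡⇒isTriple elements≡ , collinear-pointwise columnSum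
  where
  columnSum : ∀ ρ → (lookup (colB cols keep p) ρ +₃ lookup (colB cols keep q) ρ) +₃ lookup (colB cols keep r) ρ ≡ 0₃
  columnSum ρ = begin
    (lookup (colB cols keep p) ρ +₃ lookup (colB cols keep q) ρ) +₃ lookup (colB cols keep r) ρ
      ≡⟨ sym (cong₂ _+₃_ (cong₂ _+₃_ (lookup-rowB cols keep ρ p) (lookup-rowB cols keep ρ q)) (lookup-rowB cols keep ρ r)) ⟩
    (lookup (rowB cols keep ρ) p +₃ lookup (rowB cols keep ρ) q) +₃ lookup (rowB cols keep ρ) r
      ≡⟨ sym (dot-indicator-triple (rowB cols keep ρ) elements≡) ⟩
    dot (rowB cols keep ρ) (indicator s)
      ≡⟨ rows ρ ⟩
    0₃ ∎
    where open ≡-Reasoning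

-- The decomposition

module Groups {n m} (cols : Fin (3 ^ n) → Vec F3 n) (keep : Fin m → Fin n) where

  lookup-G : ∀ u i → lookup (G cols keep u) i ≡ does (colB cols keep i ≟ⱽ u)
  lookup-G u i = VecP.lookup∘tabulate _ i

  ∈G⁻ : ∀ {u i} → i Subset.∈ G cols keep u → colB cols keep i ≡ u
  ∈G⁻ {u} {i} i∈G with colB cols keep i ≟ⱽ u | trans (sym (lookup-G u i)) (VecP.[]=⇒lookup i∈G)
  ... | yes eq | _ = eq

  ∈G⁺ : ∀ {u i} → colB cols keep i ≡ u → i Subset.∈ G cols keep u
  ∈G⁺ {u} {i} eq = VecP.lookup⇒[]= i (G cols keep u) (trans (lookup-G u i) (dec-true (colB cols keep i ≟ⱽ u) eq))

  ∣G∣≡3^[n∸m] : Injective _≡_ _≡_ cols → StrictlyMonotone keep → ∀ u → ∣ G cols keep u ∣ ≡ 3 ^ (n ∸ m)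
  ∣G∣≡3^[n∸m] cols-inj mono u = begin
    ∣ G cols keep u ∣                              ≡⟨ ∣p∣≡∑𝟙 (G cols keep u) ⟩
    ∑[ i < 3 ^ n ] 𝟙 (i ∈? G cols keep u)          ≡⟨ sum-cong-≗ (λ i → 𝟙-cong (i ∈? G cols keep u)
                                                        (u ≟ⱽ project keep (cols i)) (sym ∘ ∈G⁻) (∈G⁺ ∘ sym)) ⟩
    ∑[ i < 3 ^ n ] 𝟙 (u ≟ⱽ project keep (cols i)) ≡⟨ ∑-injective≡∑ⱽ n cols cols-inj (λ v → 𝟙 (u ≟ⱽ project keep v)) ⟩
    ∑ⱽ n (λ v → 𝟙 (u ≟ⱽ project keep v))           ≡⟨ ∑ⱽ-fibre n keep mono u ⟩
    3 ^ (n ∸ m)                                    ∎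
    where open ≡-Reasoning

  G-disjoint : ∀ {u v} → u ≢ v → Disjoint (G cols keep u) (G cols keep v)
  G-disjoint {u} {v} u≢v = SubsetP.Empty-unique λ (i , i∈G∩G) →
    let i∈Gu , i∈Gv = SubsetP.x∈p∩q⁻ (G cols keep u) (G cols keep v) i∈G∩G in
    u≢v (trans (sym (∈G⁻ i∈Gu)) (∈G⁻ i∈Gv))

module Decomposition {n m} (cols : Fin (3 ^ n) → Vec F3 n) (keep : Fin m → Fin n)
                     {g} (∣G∣≡g : ∀ u → ∣ G cols keep u ∣ ≡ g)
                     (ℬ : List (Subset (3 ^ n))) (sts : IsSTS ⊤ ℬ) (dBlocks : All (IsDBlock cols keep) ℬ) where

  private
    N : ℕ
    N = 3 ^ n
    col : Fin N → Vec F3 m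
    col = colB cols keep
    group : Vec F3 m → Subset N
    group = G cols keep
    ℬ-unique : Unique ℬ
    ℬ-unique = proj₁ sts
    ∣b∣≡3 : ∀ {b} → b ∈ ℬ → ∣ b ∣ ≡ 3
    ∣b∣≡3 {b} b∈ℬ = proj₁ (proj₁ (proj₂ sts) b b∈ℬ)
    ℬ-atMostOne : ∀ {i j} → i ≢ j → ∀ {b b′} → b ∈ ℬ → b′ ∈ ℬ →
                  i Subset.∈ b → j Subset.∈ b → i Subset.∈ b′ → j Subset.∈ b′ → b ≡ b′
    ℬ-atMostOne {i} {j} i≢j {b} {b′} = proj₂ (proj₂ (proj₂ sts)) i j i≢j b b′

  open Groups cols keep using (∈G⁺; ∈G⁻; G-disjoint)

  PairThrough : List (Subset N) → Fin N → Fin N → Set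
  PairThrough xs i j = ∃ λ x → x ∈ xs × i Subset.∈ x × j Subset.∈ x

  along : ∀ {xs ys i j} → xs ≡ ys → PairThrough ys i j → PairThrough xs i j
  along refl through = through

  blockTriple : ∀ {x} → x ∈ ℬ → ∃₂ λ p q → ∃ λ r → ZeroSumTriple col x p q r
  blockTriple x∈ℬ = dBlock⇒zeroSumTriple {cols = cols} {keep} (All.lookup dBlocks x∈ℬ)

  blockThrough : ∀ {i j} → i ≢ j → ∃ λ x → x ∈ ℬ × ∃ λ k → ZeroSumTriple col x i j k
  blockThrough {i} {j} i≢j =
    let x , x∈ℬ , i∈x , j∈x = proj₁ (proj₂ (proj₂ sts)) i j SubsetP.∈⊤ SubsetP.∈⊤ i≢j
        _ , _ , _ , pqr = blockTriple x∈ℬ in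
    x , x∈ℬ , completeTriple pqr i∈x j∈x i≢j

  triple⊆G : ∀ {x p q r u} → ZeroSumTriple col x p q r → col p ≡ u → col q ≡ u → x Subset.⊆ group u
  triple⊆G {u = u} (t , pqr) refl cq≡u y∈x with IsTriple.∈-cases t y∈x
  ... | inj₁ refl        = ∈G⁺ refl
  ... | inj₂ (inj₁ refl) = ∈G⁺ cq≡u
  ... | inj₂ (inj₂ refl) = ∈G⁺ (collinear-diagonal u (subst (λ c → Collinear u c _) cq≡u pqr))

  ℬᵤ : Vec F3 m → List (Subset N)
  ℬᵤ u = filter (SubsetP._⊆? group u) ℬ

  ∈ℬᵤ⁻ : ∀ {x u} → x ∈ ℬᵤ u → x ∈ ℬ × x Subset.⊆ group u
  ∈ℬᵤ⁻ {u = u} = ListMP.∈-filter⁻ (SubsetP._⊆? group u)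

  ℬᵤ-isSTS : ∀ u → IsSTS (group u) (ℬᵤ u)
  ℬᵤ-isSTS u = UniqueP.filter⁺ (SubsetP._⊆? group u) ℬ-unique , blocks , cover , atMostOne
    where
    blocks : ∀ b → b ∈ ℬᵤ u → ∣ b ∣ ≡ 3 × b Subset.⊆ group u
    blocks b b∈ℬᵤ = let b∈ℬ , b⊆G = ∈ℬᵤ⁻ b∈ℬᵤ in ∣b∣≡3 b∈ℬ , b⊆G
    cover : ∀ i j → i Subset.∈ group u → j Subset.∈ group u → i ≢ j → PairThrough (ℬᵤ u) i j
    cover i j i∈G j∈G i≢j =
      let x , x∈ℬ , k , ijk = blockThrough i≢j in
      x , ListMP.∈-filter⁺ (SubsetP._⊆? group u) x∈ℬ (triple⊆G ijk (∈G⁻ i∈G) (∈G⁻ j∈G))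
        , IsTriple.p∈s (proj₁ ijk) , IsTriple.q∈s (proj₁ ijk)
    atMostOne : ∀ i j → i ≢ j → ∀ b b′ → b ∈ ℬᵤ u → b′ ∈ ℬᵤ u →
                i Subset.∈ b → j Subset.∈ b → i Subset.∈ b′ → j Subset.∈ b′ → b ≡ b′
    atMostOne i j i≢j b b′ b∈ b′∈ = ℬ-atMostOne i≢j (proj₁ (∈ℬᵤ⁻ b∈)) (proj₁ (∈ℬᵤ⁻ b′∈))

  length-ℬᵤ : ∀ u → length (ℬᵤ u) ≡ (g * (g ∸ 1)) / 6
  length-ℬᵤ u = begin
    length (ℬᵤ u)                     ≡⟨ sym (m*n/n≡m (length (ℬᵤ u)) 6) ⟩
    length (ℬᵤ u) * 6 / 6             ≡⟨ cong (_/ 6) (sts-size (ℬᵤ-isSTS u)) ⟩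
    ∣ group u ∣ * (∣ group u ∣ ∸ 1) / 6 ≡⟨ cong (λ k → k * (k ∸ 1) / 6) (∣G∣≡g u) ⟩
    g * (g ∸ 1) / 6                   ∎
    where open ≡-Reasoning

  record Transversal (a b c : Vec F3 m) (x : Subset N) : Set where
    constructor transversal
    field
      meets-a : ∣ x ∩ group a ∣ ≡ 1
      meets-b : ∣ x ∩ group b ∣ ≡ 1
      meets-c : ∣ x ∩ group c ∣ ≡ 1

  transversal? : ∀ a b c x → Dec (Transversal a b c x)
  transversal? a b c x = Dec.map′ (λ (A , B , C) → transversal A B C) (λ (transversal A B C) → A , B , C)
    (∣ x ∩ group a ∣ ℕ.≟ 1 ×-dec ∣ x ∩ group b ∣ ℕ.≟ 1 ×-dec ∣ x ∩ group c ∣ ℕ.≟ 1)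

  transversal-swap₁₂ : ∀ {a b c x} → Transversal a b c x → Transversal b a c x
  transversal-swap₁₂ (transversal A B C) = transversal B A C

  transversal-swap₂₃ : ∀ {a b c x} → Transversal a b c x → Transversal a c b x
  transversal-swap₂₃ (transversal A B C) = transversal A C B

  transversal-point : ∀ {a x} → ∣ x ∩ group a ∣ ≡ 1 → ∃ λ y → y Subset.∈ x × col y ≡ a
  transversal-point {a} {x} ∣x∩Ga∣≡1 =
    let y , y∈x∩Ga = ∣p∣≡suc⇒nonempty ∣x∩Ga∣≡1
        y∈x , y∈Ga = SubsetP.x∈p∩q⁻ x (group a) y∈x∩Ga in
    y , y∈x , ∈G⁻ y∈Ga

  ∣triple∩G∣≡1 : ∀ {x p q r a} → IsTriple x p q r → col p ≡ a → col q ≢ a → col r ≢ a → ∣ x ∩ group a ∣ ≡ 1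
  ∣triple∩G∣≡1 {x} {p} {q} {r} {a} t cp≡a cq≢a cr≢a =
    ∣p∣≡1 (SubsetP.x∈p∩q⁺ (IsTriple.p∈s t , ∈G⁺ cp≡a)) only-p
    where
    only-p : ∀ {y} → y Subset.∈ x ∩ group a → y ≡ p
    only-p y∈x∩Ga with SubsetP.x∈p∩q⁻ x (group a) y∈x∩Ga
    ... | y∈x , y∈Ga with IsTriple.∈-cases t y∈x
    ...   | inj₁ y≡p        = y≡p
    ...   | inj₂ (inj₁ refl) = contradiction (∈G⁻ y∈Ga) cq≢a
    ...   | inj₂ (inj₂ refl) = contradiction (∈G⁻ y∈Ga) cr≢a

  lineTriple⇒transversal : ∀ {a b c x p q r} → IsLine a b c → ZeroSumTriple col x p q r →
                           col p ≡ a → col q ≡ b → Transversal a b c x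
  lineTriple⇒transversal {c = c} {r = r} (a≢b , a≢c , b≢c , abc) (t , pqr) refl refl = transversal
      (∣triple∩G∣≡1 t refl (a≢b ∘ sym) (λ cr≡a → a≢c (trans (sym cr≡a) cr≡c)))
      (∣triple∩G∣≡1 (isTriple-swap₁₂ t) refl a≢b (λ cr≡b → b≢c (trans (sym cr≡b) cr≡c)))
      (∣triple∩G∣≡1 (isTriple-swap₁₂ (isTriple-swap₂₃ t)) cr≡c a≢c b≢c)
    where
    cr≡c : col r ≡ c
    cr≡c = collinear-unique pqr abc

  ℬₗ : Vec F3 m → Vec F3 m → Vec F3 m → List (Subset N)
  ℬₗ a b c = filter (transversal? a b c) ℬ

  ∈ℬₗ⁻ : ∀ {x a b c} → x ∈ ℬₗ a b c → x ∈ ℬ × Transversal a b c x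
  ∈ℬₗ⁻ {a = a} {b} {c} = ListMP.∈-filter⁻ (transversal? a b c)

  ℬₗ-swap₁₂ : ∀ a b c → ℬₗ a b c ≡ ℬₗ b a c
  ℬₗ-swap₁₂ a b c = ListP.filter-≐ (transversal? a b c) (transversal? b a c) (transversal-swap₁₂ , transversal-swap₁₂) ℬ

  ℬₗ-swap₂₃ : ∀ a b c → ℬₗ a b c ≡ ℬₗ a c b
  ℬₗ-swap₂₃ a b c = ListP.filter-≐ (transversal? a b c) (transversal? a c b) (transversal-swap₂₃ , transversal-swap₂₃) ℬ

  separated : ∀ {u v i j} → u ≢ v → i Subset.∈ group u → j Subset.∈ group v → i ≢ j
  separated u≢v i∈Gu j∈Gv refl = u≢v (trans (sym (∈G⁻ i∈Gu)) (∈G⁻ j∈Gv))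

  transversalThrough : ∀ {a b c i j} → IsLine a b c → i Subset.∈ group a → j Subset.∈ group b →
                       PairThrough (ℬₗ a b c) i j
  transversalThrough {a} {b} {c} line@(a≢b , _) i∈Ga j∈Gb =
    let x , x∈ℬ , k , ijk = blockThrough (separated a≢b i∈Ga j∈Gb) in
    x , ListMP.∈-filter⁺ (transversal? a b c) x∈ℬ (lineTriple⇒transversal line ijk (∈G⁻ {a} i∈Ga) (∈G⁻ {b} j∈Gb))
      , IsTriple.p∈s (proj₁ ijk) , IsTriple.q∈s (proj₁ ijk)

  transversalColumns : ∀ {a b c x y} → IsLine a b c → x ∈ ℬ → Transversal a b c x → y Subset.∈ x →
                       col y ≡ a ⊎ col y ≡ b ⊎ col y ≡ c
  transversalColumns {a} {b} {c} (a≢b , _ , _ , abc) x∈ℬ (transversal A B _) y∈x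
    with transversal-point {a} A | transversal-point {b} B
  ... | yₐ , yₐ∈x , refl | y_b , y_b∈x , refl
    with blockTriple x∈ℬ
  ... | _ , _ , _ , pqr
    with completeTriple pqr yₐ∈x y_b∈x (separated a≢b (∈G⁺ refl) (∈G⁺ refl))
  ... | k , t , abk
    with IsTriple.∈-cases t y∈x
  ... | inj₁ refl        = inj₁ refl
  ... | inj₂ (inj₁ refl) = inj₂ (inj₁ refl)
  ... | inj₂ (inj₂ refl) = inj₂ (inj₂ (collinear-unique abk abc))

  diffGroups⇒≢ : ∀ {a b c i j} → IsLine a b c → DiffGroups (group a) (group b) (group c) i j → i ≢ j
  diffGroups⇒≢ (a≢b , a≢c , b≢c , _) (inj₁ (i∈ , j∈))                             = separated a≢b i∈ j∈
  diffGroups⇒≢ (a≢b , a≢c , b≢c , _) (inj₂ (inj₁ (i∈ , j∈)))                      = separated a≢c i∈ j∈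
  diffGroups⇒≢ (a≢b , a≢c , b≢c , _) (inj₂ (inj₂ (inj₁ (i∈ , j∈))))               = separated (a≢b ∘ sym) i∈ j∈
  diffGroups⇒≢ (a≢b , a≢c , b≢c , _) (inj₂ (inj₂ (inj₂ (inj₁ (i∈ , j∈)))))        = separated b≢c i∈ j∈
  diffGroups⇒≢ (a≢b , a≢c , b≢c , _) (inj₂ (inj₂ (inj₂ (inj₂ (inj₁ (i∈ , j∈)))))) = separated (a≢c ∘ sym) i∈ j∈
  diffGroups⇒≢ (a≢b , a≢c , b≢c , _) (inj₂ (inj₂ (inj₂ (inj₂ (inj₂ (i∈ , j∈)))))) = separated (b≢c ∘ sym) i∈ j∈

  ℬₗ-cover : ∀ {a b c i j} → IsLine a b c → DiffGroups (group a) (group b) (group c) i j → PairThrough (ℬₗ a b c) i j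
  ℬₗ-cover line (inj₁ (i∈ , j∈)) = transversalThrough line i∈ j∈
  ℬₗ-cover {a} {b} {c} line (inj₂ (inj₁ (i∈ , j∈))) =
    along (ℬₗ-swap₂₃ a b c) (transversalThrough (isLine-swap₂₃ line) i∈ j∈)
  ℬₗ-cover {a} {b} {c} line (inj₂ (inj₂ (inj₁ (i∈ , j∈)))) =
    along (ℬₗ-swap₁₂ a b c) (transversalThrough (isLine-swap₁₂ line) i∈ j∈)
  ℬₗ-cover {a} {b} {c} line (inj₂ (inj₂ (inj₂ (inj₁ (i∈ , j∈))))) =
    along (trans (ℬₗ-swap₁₂ a b c) (ℬₗ-swap₂₃ b a c))
          (transversalThrough (isLine-swap₂₃ (isLine-swap₁₂ line)) i∈ j∈)
  ℬₗ-cover {a} {b} {c} line (inj₂ (inj₂ (inj₂ (inj₂ (inj₁ (i∈ , j∈)))))) =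
    along (trans (ℬₗ-swap₂₃ a b c) (ℬₗ-swap₁₂ a c b))
          (transversalThrough (isLine-swap₁₂ (isLine-swap₂₃ line)) i∈ j∈)
  ℬₗ-cover {a} {b} {c} line (inj₂ (inj₂ (inj₂ (inj₂ (inj₂ (i∈ , j∈)))))) =
    along (trans (ℬₗ-swap₁₂ a b c) (trans (ℬₗ-swap₂₃ b a c) (ℬₗ-swap₁₂ b c a)))
          (transversalThrough (isLine-swap₁₂ (isLine-swap₂₃ (isLine-swap₁₂ line))) i∈ j∈)

  ℬₗ-isTD : ∀ {a b c} → IsLine a b c → IsTD (group a) (group b) (group c) g (ℬₗ a b c)
  ℬₗ-isTD {a} {b} {c} line@(a≢b , a≢c , b≢c , _) =
      ∣G∣≡g a , ∣G∣≡g b , ∣G∣≡g c , G-disjoint a≢b , G-disjoint a≢c , G-disjoint b≢c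
    , UniqueP.filter⁺ (transversal? a b c) ℬ-unique
    , (λ x x∈ℬₗ → let x∈ℬ , transversal A B C = ∈ℬₗ⁻ x∈ℬₗ in ∣b∣≡3 x∈ℬ , A , B , C)
    , (λ i j → ℬₗ-cover line)
    , (λ i j d x x′ x∈ x′∈ → ℬ-atMostOne (diffGroups⇒≢ {a} {b} {c} line d) (proj₁ (∈ℬₗ⁻ x∈)) (proj₁ (∈ℬₗ⁻ x′∈)))

  length-ℬₗ : ∀ {a b c} → IsLine a b c → length (ℬₗ a b c) ≡ g * g
  length-ℬₗ line = td-size (ℬₗ-isTD line)

  ℬ-decomposition : ∀ x → x ∈ ℬ ⇔ ((Σ (Vec F3 m) λ u → x ∈ ℬᵤ u)
                                       ⊎ (Σ (Vec F3 m) λ a → Σ (Vec F3 m) λ b → Σ (Vec F3 m) λ c →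
                                            IsLine a b c × x ∈ ℬₗ a b c))
  ℬ-decomposition x = mk⇔ to from
    where
    to : x ∈ ℬ → (Σ (Vec F3 m) λ u → x ∈ ℬᵤ u)
                       ⊎ (Σ (Vec F3 m) λ a → Σ (Vec F3 m) λ b → Σ (Vec F3 m) λ c → IsLine a b c × x ∈ ℬₗ a b c)
    to x∈ℬ with blockTriple x∈ℬ
    ... | p , q , r , pqr with col p ≟ⱽ col q
    ...   | yes cp≡cq = inj₁ (col p , ListMP.∈-filter⁺ (SubsetP._⊆? group (col p)) x∈ℬ (triple⊆G pqr refl (sym cp≡cq)))
    ...   | no cp≢cq  = inj₂ (col p , col q , col r , line ,
                              ListMP.∈-filter⁺ (transversal? (col p) (col q) (col r)) x∈ℬ (lineTriple⇒transversal line pqr refl refl))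
      where
      line : IsLine (col p) (col q) (col r)
      line = collinear⇒isLine (proj₂ pqr) cp≢cq
    from : (Σ (Vec F3 m) λ u → x ∈ ℬᵤ u)
           ⊎ (Σ (Vec F3 m) λ a → Σ (Vec F3 m) λ b → Σ (Vec F3 m) λ c → IsLine a b c × x ∈ ℬₗ a b c) → x ∈ ℬ
    from (inj₁ (u , x∈ℬᵤ))              = proj₁ (∈ℬᵤ⁻ x∈ℬᵤ)
    from (inj₂ (a , b , c , _ , x∈ℬₗ)) = proj₁ (∈ℬₗ⁻ x∈ℬₗ)

  ℬᵤ-disjoint : ∀ {x u u′} → x ∈ ℬᵤ u → x ∈ ℬᵤ u′ → u ≡ u′
  ℬᵤ-disjoint {x} {u} {u′} x∈ℬᵤ x∈ℬᵤ′ =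
    let x∈ℬ , x⊆Gu = ∈ℬᵤ⁻ x∈ℬᵤ
        _ , x⊆Gu′ = ∈ℬᵤ⁻ x∈ℬᵤ′
        y , y∈x = ∣p∣≡suc⇒nonempty (∣b∣≡3 x∈ℬ) in
    trans (sym (∈G⁻ {u} (x⊆Gu y∈x))) (∈G⁻ {u′} (x⊆Gu′ y∈x))

  ℬᵤ-ℬₗ-disjoint : ∀ {x u a b c} → IsLine a b c → x ∈ ℬᵤ u → x ∉ ℬₗ a b c
  ℬᵤ-ℬₗ-disjoint {x} {u} {a} {b} {c} (a≢b , _) x∈ℬᵤ x∈ℬₗ =
    let x⊆Gu = proj₂ (∈ℬᵤ⁻ x∈ℬᵤ)
        transversal A B _ = proj₂ (∈ℬₗ⁻ x∈ℬₗ)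
        yₐ , yₐ∈x , cyₐ≡a = transversal-point {a} A
        y_b , y_b∈x , cy_b≡b = transversal-point {b} B in
    a≢b (trans (sym cyₐ≡a) (trans (∈G⁻ {u} (x⊆Gu yₐ∈x)) (trans (sym (∈G⁻ {u} (x⊆Gu y_b∈x))) cy_b≡b)))

  ℬₗ-sameLine : ∀ {x a b c a′ b′ c′} → IsLine a b c → x ∈ ℬₗ a b c → x ∈ ℬₗ a′ b′ c′ →
                SameLine (a , b , c) (a′ , b′ , c′)
  ℬₗ-sameLine {x} {a} {b} {c} {a′} {b′} {c′} line x∈ℬₗ x∈ℬₗ′ = onLine a′ A′ , onLine b′ B′ , onLine c′ C′
    where
    T′ : Transversal a′ b′ c′ x
    T′ = proj₂ (∈ℬₗ⁻ x∈ℬₗ′)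
    open Transversal T′ renaming (meets-a to A′; meets-b to B′; meets-c to C′)
    onLine : ∀ w → ∣ x ∩ group w ∣ ≡ 1 → w ∈₃ (a , b , c)
    onLine w meets-w =
      let x∈ℬ , T = ∈ℬₗ⁻ x∈ℬₗ
          y , y∈x , cy≡w = transversal-point {w} meets-w in
      Sum.map (trans (sym cy≡w)) (Sum.map (trans (sym cy≡w)) (trans (sym cy≡w))) (transversalColumns line x∈ℬ T y∈x)

theorem3p8 :
  (n t : ℕ) → 2 ≤ n → 1 ≤ t → t ≤ n ∸ 1 →
  (cols : Fin (3 ^ n) → Vec F3 n) →
  (∀ i j → cols i ≡ cols j → i ≡ j) →
  (keep : Fin (n ∸ t) → Fin n) →
  (∀ r s → r Data.Fin.< s → keep r Data.Fin.< keep s) →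
  (ℬ : List (Subset (3 ^ n))) →
  IsSTS ⊤ ℬ →
  All (IsDBlock cols keep) ℬ →
  Σ (Vec F3 (n ∸ t) → List (Subset (3 ^ n))) λ ℬu →
  Σ (Vec F3 (n ∸ t) → Vec F3 (n ∸ t) → Vec F3 (n ∸ t) → List (Subset (3 ^ n))) λ ℬl →
    -- (1) the pieces for the points of AG(n-t,3)
    (∀ u → IsSTS (G cols keep u) (ℬu u) × (length (ℬu u) ≡ ((3 ^ t) * ((3 ^ t) ∸ 1)) / 6))
    -- (2) the pieces for the lines of AG(n-t,3); ℬl depends only on the line as a set
    × (∀ a b c → IsLine a b c →
         IsTD (G cols keep a) (G cols keep b) (G cols keep c) (3 ^ t) (ℬl a b c)
         × (length (ℬl a b c) ≡ 3 ^ (2 * t)))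
    × (∀ a b c → (ℬl a b c ≡ ℬl b a c) × (ℬl a b c ≡ ℬl a c b))
    -- ℬ is the union of all pieces
    × (∀ x → x ∈ ℬ ⇔ ((Σ (Vec F3 (n ∸ t)) λ u → x ∈ ℬu u)
                     ⊎ (Σ (Vec F3 (n ∸ t)) λ a → Σ (Vec F3 (n ∸ t)) λ b → Σ (Vec F3 (n ∸ t)) λ c →
                          IsLine a b c × x ∈ ℬl a b c)))
    -- and the union is disjoint
    × (∀ x u u' → x ∈ ℬu u → x ∈ ℬu u' → u ≡ u')
    × (∀ x u a b c → IsLine a b c → x ∈ ℬu u → x ∉ ℬl a b c)
    × (∀ x a b c a' b' c' → IsLine a b c → IsLine a' b' c' →
         x ∈ ℬl a b c → x ∈ ℬl a' b' c' → SameLine (a , b , c) (a' , b' , c'))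
theorem3p8 n t _ _ t≤n∸1 cols cols-inj keep keep-mono ℬ sts dBlocks =
    ℬᵤ , ℬₗ
  , (λ u → ℬᵤ-isSTS u , length-ℬᵤ u)
  , (λ a b c line → ℬₗ-isTD line , trans (length-ℬₗ line) 3^t*3^t≡3^[2t])
  , (λ a b c → ℬₗ-swap₁₂ a b c , ℬₗ-swap₂₃ a b c)
  , ℬ-decomposition
  , (λ x u u′ → ℬᵤ-disjoint)
  , (λ x u a b c line → ℬᵤ-ℬₗ-disjoint line)
  , (λ x a b c a′ b′ c′ line _ → ℬₗ-sameLine line)
  where
  ∣G∣≡3^t : ∀ u → ∣ G cols keep u ∣ ≡ 3 ^ t
  ∣G∣≡3^t u = trans (Groups.∣G∣≡3^[n∸m] cols keep (cols-inj _ _) (keep-mono _ _) u)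
                    (cong (3 ^_) (ℕP.m∸[m∸n]≡n (ℕP.≤-trans t≤n∸1 (ℕP.m∸n≤m n 1))))
  3^t*3^t≡3^[2t] : 3 ^ t * 3 ^ t ≡ 3 ^ (2 * t)
  3^t*3^t≡3^[2t] = trans (sym (ℕP.^-distribˡ-+-* 3 t t)) (cong (λ k → 3 ^ (t + k)) (sym (ℕP.+-identityʳ t)))
  open Decomposition cols keep ∣G∣≡3^t ℬ sts dBlocks
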